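{- For $k\ge1$, the number of order ideals of ${\sf V}_k$ is $\sum_{i=1}^{k+1}i^2=\frac{(k+1)(k+2)(2k+3)}{6}$.
   Context: ${\sf V}$ is the 3-element poset with elements $c,\ell,r$ and relations $c<\ell$, $c<r$; ${\sf V}_k={\sf V}\times[k]$ with the product order, $[k]=\{1<\dots<k\}$. -}

module Defs where

open import Data.Nat using (ℕ; zero; suc)
open import Data.Fin using (Fin)
import Data.Fin as F
open import Data.Fin.Properties using (all?)
import Data.Fin.Properties as FP
open import Data.Fin.Subset using (Subset; _∈_; inside; outside)
open import Data.Fin.Subset.Properties using (_∈?_)
open import Data.Product using (_×_; _,_)
open import Data.List using (List; []; _∷_; map; concatMap; cartesianProduct; filter; length)
open import Data.Vec using (_∷_; [])
open import Relation.Nullary using (Dec; yes; no)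
open import Relation.Nullary.Decidable using (_×-dec_; _→-dec_)

data V : Set where
  c ℓ r : V

data _≤V_ : V → V → Set where
  c≤c : c ≤V c
  ℓ≤ℓ : ℓ ≤V ℓ
  r≤r : r ≤V r
  c≤ℓ : c ≤V ℓ
  c≤r : c ≤V r

Vk : ℕ → Set
Vk k = V × Fin k

_≤Vk_ : ∀ {k} → Vk k → Vk k → Set
(a , i) ≤Vk (b , j) = (a ≤V b) × (i F.≤ j)

-- A subset of V_k: one subset of [k] for each of c, ℓ, r.
SubVk : ℕ → Set
SubVk k = Subset k × Subset k × Subset k

fibre : ∀ {k} → V → SubVk k → Subset k
fibre c (Sc , Sℓ , Sr) = Sc
fibre ℓ (Sc , Sℓ , Sr) = Sℓ
fibre r (Sc , Sℓ , Sr) = Sr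

_∈Vk_ : ∀ {k} → Vk k → SubVk k → Set
(a , i) ∈Vk S = i ∈ fibre a S

IsOrderIdeal : ∀ {k} → SubVk k → Set
IsOrderIdeal {k} S = (x y : Vk k) → y ≤Vk x → x ∈Vk S → y ∈Vk S

_≤V?_ : (a b : V) → Dec (a ≤V b)
c ≤V? c = yes c≤c
c ≤V? ℓ = yes c≤ℓ
c ≤V? r = yes c≤r
ℓ ≤V? c = no (λ ())
ℓ ≤V? ℓ = yes ℓ≤ℓ
ℓ ≤V? r = no (λ ())
r ≤V? c = no (λ ())
r ≤V? ℓ = no (λ ())
r ≤V? r = yes r≤r

allV? : {P : V → Set} → ((a : V) → Dec (P a)) → Dec ((a : V) → P a)
allV? P? with P? c | P? ℓ | P? r
... | yes pc | yes pℓ | yes pr = yes λ { c → pc ; ℓ → pℓ ; r → pr }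
... | no ¬p | _ | _ = no λ f → ¬p (f c)
... | yes _ | no ¬p | _ = no λ f → ¬p (f ℓ)
... | yes _ | yes _ | no ¬p = no λ f → ¬p (f r)

allVk? : ∀ {k} {P : Vk k → Set} → ((x : Vk k) → Dec (P x)) → Dec ((x : Vk k) → P x)
allVk? P? with allV? (λ a → all? (λ i → P? (a , i)))
... | yes f = yes λ { (a , i) → f a i }
... | no ¬f = no λ g → ¬f (λ a i → g (a , i))

isOrderIdeal? : ∀ {k} (S : SubVk k) → Dec (IsOrderIdeal S)
isOrderIdeal? S = allVk? λ { (a , i) → allVk? λ { (b , j) →
  ((b ≤V? a) ×-dec (j FP.≤? i)) →-dec ((i ∈? fibre a S) →-dec (j ∈? fibre b S)) } }

allSubsets : (n : ℕ) → List (Subset n)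
allSubsets zero = [] ∷ []
allSubsets (suc n) = concatMap (λ s → (outside ∷ s) ∷ (inside ∷ s) ∷ []) (allSubsets n)

allSubVk : (k : ℕ) → List (SubVk k)
allSubVk k = cartesianProduct (allSubsets k) (cartesianProduct (allSubsets k) (allSubsets k))

numOrderIdeals : ℕ → ℕ
numOrderIdeals k = length (filter isOrderIdeal? (allSubVk k))

{-# OPTIONS --safe #-}
module Submission where

-- An order ideal of V_k is a triple (S_c, S_ℓ, S_r) of down-sets of [k] with S_ℓ, S_r ⊆ S_c.
-- The down-sets of [k] are the initial segments {1..m}, 0 ≤ m ≤ k, and {1..m} contains
-- exactly m + 1 of them, so the number of ideals is Σ_{m=0}^{k} (m + 1)².

import Data.Nat.Properties as ℕₚ
open import Defs
open import Algebra.Properties.CommutativeSemigroup ℕₚ.+-commutativeSemigroup using (interchange)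
open import Data.Bool using (Bool; true; false; _∧_)
open import Data.Bool.Properties using (∧-zeroʳ)
open import Data.Fin using (Fin; zero)
import Data.Fin as F
import Data.Fin.Properties as FP
open import Data.Fin.Subset using (Subset; _∈_; _⊆_; Empty; inside; outside)
open import Data.Fin.Subset.Properties using (_⊆?_; drop-there; drop-∷-Empty; Empty-unique; ⊥⊆)
open import Data.List using (List; []; _∷_; _++_; _∷ʳ_; map; filter; length; applyUpTo; cartesianProduct; concatMap)
open import Data.List.Properties using (map-++; map-cong; map-∘; applyUpTo-∷ʳ)
open import Data.Nat using (ℕ; zero; suc; _+_; _*_; _≤_; z≤n; s≤s)
open import Data.Nat.DivMod using (_/_; m*n/n≡m)
open import Data.Nat.ListAction using (sum)
open import Data.Nat.ListAction.Properties using (sum-++)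
open import Data.Nat.Tactic.RingSolver using (solve-∀)
open import Data.Product using (_×_; _,_)
open import Data.Vec using ([]; _∷_)
open import Data.Vec.Base using (here; there)
open import Function using (_∘_; _⇔_; mk⇔)
open import Relation.Nullary using (Dec; yes; no; does; contradiction)
open import Relation.Nullary.Decidable using (map′; _×-dec_; dec-true; does-⇔)
open import Relation.Binary.PropositionalEquality using (_≡_; refl; sym; trans; cong; cong₂; subst; module ≡-Reasoning)

private variable
  A B : Set
  n : ℕ

χ : Bool → ℕ
χ true = 1
χ false = 0

χ-∧ : ∀ a b → χ (a ∧ b) ≡ χ a * χ b
χ-∧ true b = sym (ℕₚ.*-identityˡ (χ b))
χ-∧ false b = refl

∑ : List A → (A → ℕ) → ℕ
∑ xs f = sum (map f xs)

∑-syntax : List A → (A → ℕ) → ℕ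
∑-syntax = ∑

syntax ∑-syntax xs (λ x → e) = ∑[ x ∈ xs ] e

∑-cong : (xs : List A) {f g : A → ℕ} → (∀ x → f x ≡ g x) → ∑ xs f ≡ ∑ xs g
∑-cong xs f≗g = cong sum (map-cong f≗g xs)

∑-++ : (xs ys : List A) (f : A → ℕ) → ∑ (xs ++ ys) f ≡ ∑ xs f + ∑ ys f
∑-++ xs ys f = trans (cong sum (map-++ f xs ys)) (sum-++ (map f xs) (map f ys))

∑-map : (g : A → B) (xs : List A) (f : B → ℕ) → ∑ (map g xs) f ≡ ∑ xs (f ∘ g)
∑-map g xs f = cong sum (sym (map-∘ xs))

∑-zero : (xs : List A) → ∑[ x ∈ xs ] 0 ≡ 0
∑-zero [] = refl
∑-zero (x ∷ xs) = ∑-zero xs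

∑-*ˡ : (xs : List A) (m : ℕ) (f : A → ℕ) → ∑[ x ∈ xs ] (m * f x) ≡ m * ∑ xs f
∑-*ˡ [] m f = sym (ℕₚ.*-zeroʳ m)
∑-*ˡ (x ∷ xs) m f =
  trans (cong (m * f x +_) (∑-*ˡ xs m f)) (sym (ℕₚ.*-distribˡ-+ m (f x) (∑ xs f)))

∑-*ʳ : (xs : List A) (m : ℕ) (f : A → ℕ) → ∑[ x ∈ xs ] (f x * m) ≡ ∑ xs f * m
∑-*ʳ xs m f = begin
  ∑[ x ∈ xs ] (f x * m)  ≡⟨ ∑-cong xs (λ x → ℕₚ.*-comm (f x) m) ⟩
  ∑[ x ∈ xs ] (m * f x)  ≡⟨ ∑-*ˡ xs m f ⟩
  m * ∑ xs f             ≡⟨ ℕₚ.*-comm m (∑ xs f) ⟩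
  ∑ xs f * m             ∎
  where open ≡-Reasoning

∑-cartesianProduct : (xs : List A) (ys : List B) (f : A × B → ℕ) →
  ∑ (cartesianProduct xs ys) f ≡ ∑[ x ∈ xs ] ∑[ y ∈ ys ] f (x , y)
∑-cartesianProduct [] ys f = refl
∑-cartesianProduct (x ∷ xs) ys f = begin
  ∑ (map (x ,_) ys ++ cartesianProduct xs ys) f          ≡⟨ ∑-++ (map (x ,_) ys) _ f ⟩
  ∑ (map (x ,_) ys) f + ∑ (cartesianProduct xs ys) f
    ≡⟨ cong₂ _+_ (∑-map (x ,_) ys f) (∑-cartesianProduct xs ys f) ⟩
  ∑[ y ∈ ys ] f (x , y) + ∑[ x′ ∈ xs ] ∑[ y ∈ ys ] f (x′ , y) ∎
  where open ≡-Reasoning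

∑-*-∑ : (xs : List A) (ys : List B) (f : A → ℕ) (g : B → ℕ) →
  ∑[ x ∈ xs ] ∑[ y ∈ ys ] (f x * g y) ≡ ∑ xs f * ∑ ys g
∑-*-∑ xs ys f g =
  trans (∑-cong xs (λ x → ∑-*ˡ ys (f x) g)) (∑-*ʳ xs (∑ ys g) f)

length-filter : {P : A → Set} (P? : ∀ x → Dec (P x)) (xs : List A) →
  length (filter P? xs) ≡ ∑[ x ∈ xs ] χ (does (P? x))
length-filter P? [] = refl
length-filter P? (x ∷ xs) with does (P? x)
... | true = cong suc (length-filter P? xs)
... | false = length-filter P? xs

∑-allSubsets-suc : ∀ n (f : Subset (suc n) → ℕ) →
  ∑ (allSubsets (suc n)) f ≡ ∑[ s ∈ allSubsets n ] f (outside ∷ s) + ∑[ s ∈ allSubsets n ] f (inside ∷ s)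
∑-allSubsets-suc n f = go (allSubsets n)
  where
  go : (xs : List (Subset n)) →
    ∑ (concatMap (λ s → (outside ∷ s) ∷ (inside ∷ s) ∷ []) xs) f
      ≡ ∑[ s ∈ xs ] f (outside ∷ s) + ∑[ s ∈ xs ] f (inside ∷ s)
  go [] = refl
  go (s ∷ xs) = trans (cong (λ z → fₒ + (fᵢ + z)) (go xs))
                      (trans (sym (ℕₚ.+-assoc fₒ fᵢ _)) (interchange fₒ fᵢ _ _))
    where
    fₒ = f (outside ∷ s)
    fᵢ = f (inside ∷ s)

-- Both deciders below recurse on the head bit, so that `does` reduces on `outside ∷ s`
-- and `inside ∷ s` (the library's `nonempty?` does not); the counting lemmas rely on this.
empty? : (s : Subset n) → Dec (Empty s)
empty? [] = yes λ ()
empty? (inside ∷ s) = no λ s-empty → s-empty (zero , here)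
empty? (outside ∷ s) = map′ outside-empty drop-∷-Empty (empty? s)
  where
  outside-empty : Empty s → Empty (outside ∷ s)
  outside-empty s-empty (F.suc i , there i∈s) = s-empty (i , i∈s)

∑-χ-empty : ∀ n → ∑[ s ∈ allSubsets n ] χ (does (empty? s)) ≡ 1
∑-χ-empty zero = refl
∑-χ-empty (suc n) =
  trans (∑-allSubsets-suc n (χ ∘ does ∘ empty?)) (cong₂ _+_ (∑-χ-empty n) (∑-zero (allSubsets n)))

IsDownSet : Subset n → Set
IsDownSet {n} s = {i j : Fin n} → j F.≤ i → i ∈ s → j ∈ s

isDownSet? : (s : Subset n) → Dec (IsDownSet s)
isDownSet? [] = yes λ _ ()
isDownSet? (inside ∷ s) = map′ inside-down drop-inside (isDownSet? s)
  where
  inside-down : IsDownSet s → IsDownSet (inside ∷ s)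
  inside-down s-down {j = zero} _ _ = here
  inside-down s-down {F.suc i} {F.suc j} (s≤s j≤i) (there i∈s) = there (s-down j≤i i∈s)

  drop-inside : IsDownSet (inside ∷ s) → IsDownSet s
  drop-inside down j≤i i∈s = drop-there (down (s≤s j≤i) (there i∈s))
isDownSet? (outside ∷ s) = map′ outside-down down-empty (empty? s)
  where
  outside-down : Empty s → IsDownSet (outside ∷ s)
  outside-down s-empty {F.suc i} _ (there i∈s) = contradiction (i , i∈s) s-empty

  down-empty : IsDownSet (outside ∷ s) → Empty s
  down-empty down (i , i∈s) with down {F.suc i} z≤n (there i∈s)
  ... | ()

IsDownSubset : Subset n → Subset n → Set
IsDownSubset t s = IsDownSet t × t ⊆ s

isDownSubset? : (t s : Subset n) → Dec (IsDownSubset t s)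
isDownSubset? t s = isDownSet? t ×-dec t ⊆? s

#downSubsets : Subset n → ℕ
#downSubsets {n} s = ∑[ t ∈ allSubsets n ] χ (does (isDownSubset? t s))

∑-χ-empty∧⊆ : (s : Subset n) → ∑[ t ∈ allSubsets n ] χ (does (empty? t) ∧ does (t ⊆? s)) ≡ 1
∑-χ-empty∧⊆ {n} s = trans (∑-cong (allSubsets n) drop-⊆) (∑-χ-empty n)
  where
  drop-⊆ : ∀ t → χ (does (empty? t) ∧ does (t ⊆? s)) ≡ χ (does (empty? t))
  drop-⊆ t with empty? t
  ... | yes t-empty = cong χ (dec-true (t ⊆? s) (subst (_⊆ s) (sym (Empty-unique t-empty)) ⊥⊆))
  ... | no _ = refl

#downSubsets-outside : (s : Subset n) → #downSubsets (outside ∷ s) ≡ 1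
#downSubsets-outside {n} s = begin
  #downSubsets (outside ∷ s)
    ≡⟨ ∑-allSubsets-suc n (λ t → χ (does (isDownSubset? t (outside ∷ s)))) ⟩
  ∑[ t ∈ allSubsets n ] χ (does (empty? t) ∧ does (t ⊆? s))
    + ∑[ t ∈ allSubsets n ] χ (does (isDownSet? t) ∧ false)
    ≡⟨ cong (_+ _) (∑-χ-empty∧⊆ s) ⟩
  1 + ∑[ t ∈ allSubsets n ] χ (does (isDownSet? t) ∧ false)
    ≡⟨ cong (1 +_) (∑-cong (allSubsets n) (λ t → cong χ (∧-zeroʳ (does (isDownSet? t))))) ⟩
  1 + ∑[ t ∈ allSubsets n ] 0
    ≡⟨ cong (1 +_) (∑-zero (allSubsets n)) ⟩
  1 ∎
  where open ≡-Reasoning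

#downSubsets-inside : (s : Subset n) → #downSubsets (inside ∷ s) ≡ suc (#downSubsets s)
#downSubsets-inside {n} s =
  trans (∑-allSubsets-suc n (λ t → χ (does (isDownSubset? t (inside ∷ s)))))
        (cong (_+ #downSubsets s) (∑-χ-empty∧⊆ s))

-- Stated for an arbitrary weight f because the induction step replaces f by f ∘ suc:
-- a down-set inside ∷ s contains one more down-set than s.
∑-downSets : ∀ n (f : ℕ → ℕ) →
  ∑[ s ∈ allSubsets n ] (χ (does (isDownSet? s)) * f (#downSubsets s)) ≡ sum (applyUpTo (f ∘ suc) (suc n))
∑-downSets zero f = cong (_+ 0) (ℕₚ.*-identityˡ (f 1))
∑-downSets (suc n) f = begin
  ∑[ s ∈ allSubsets (suc n) ] (χ (does (isDownSet? s)) * f (#downSubsets s))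
    ≡⟨ ∑-allSubsets-suc n (λ s → χ (does (isDownSet? s)) * f (#downSubsets s)) ⟩
  ∑[ s ∈ allSubsets n ] (χ (does (empty? s)) * f (#downSubsets (outside ∷ s)))
    + ∑[ s ∈ allSubsets n ] (χ (does (isDownSet? s)) * f (#downSubsets (inside ∷ s)))
    ≡⟨ cong₂ _+_
         (∑-cong (allSubsets n) (λ s → cong (λ m → χ (does (empty? s)) * f m) (#downSubsets-outside s)))
         (∑-cong (allSubsets n) (λ s → cong (λ m → χ (does (isDownSet? s)) * f m) (#downSubsets-inside s))) ⟩
  ∑[ s ∈ allSubsets n ] (χ (does (empty? s)) * f 1)
    + ∑[ s ∈ allSubsets n ] (χ (does (isDownSet? s)) * f (suc (#downSubsets s)))
    ≡⟨ cong₂ _+_ empty-term (∑-downSets n (f ∘ suc)) ⟩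
  f 1 + sum (applyUpTo (f ∘ suc ∘ suc) (suc n)) ∎
  where
  open ≡-Reasoning
  empty-term : ∑[ s ∈ allSubsets n ] (χ (does (empty? s)) * f 1) ≡ f 1
  empty-term = begin
    ∑[ s ∈ allSubsets n ] (χ (does (empty? s)) * f 1)
      ≡⟨ ∑-*ʳ (allSubsets n) (f 1) (χ ∘ does ∘ empty?) ⟩
    ∑[ s ∈ allSubsets n ] χ (does (empty? s)) * f 1
      ≡⟨ cong (_* f 1) (∑-χ-empty n) ⟩
    1 * f 1
      ≡⟨ ℕₚ.*-identityˡ (f 1) ⟩
    f 1 ∎

OrderIdealTriple : SubVk n → Set
OrderIdealTriple (sc , sℓ , sr) = IsDownSet sc × IsDownSubset sℓ sc × IsDownSubset sr sc

orderIdealTriple? : (S : SubVk n) → Dec (OrderIdealTriple S)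
orderIdealTriple? (sc , sℓ , sr) = isDownSet? sc ×-dec isDownSubset? sℓ sc ×-dec isDownSubset? sr sc

isOrderIdeal⇔orderIdealTriple : (S : SubVk n) → IsOrderIdeal S ⇔ OrderIdealTriple S
isOrderIdeal⇔orderIdealTriple (sc , sℓ , sr) = mk⇔ to from
  where
  S = (sc , sℓ , sr)

  to : IsOrderIdeal S → OrderIdealTriple S
  to ideal = fibre-down c≤c , (fibre-down ℓ≤ℓ , fibre-⊆ c≤ℓ) , (fibre-down r≤r , fibre-⊆ c≤r)
    where
    fibre-down : ∀ {a} → a ≤V a → IsDownSet (fibre a S)
    fibre-down {a} a≤a {i} {j} j≤i = ideal (a , i) (a , j) (a≤a , j≤i)

    fibre-⊆ : ∀ {a} → c ≤V a → fibre a S ⊆ sc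
    fibre-⊆ {a} c≤a {i} = ideal (a , i) (c , i) (c≤a , FP.≤-refl)

  from : OrderIdealTriple S → IsOrderIdeal S
  from (sc-down , (sℓ-down , sℓ⊆sc) , (sr-down , sr⊆sc)) (a , i) (b , j) (b≤a , j≤i) = down b≤a
    where
    down : b ≤V a → (a , i) ∈Vk S → (b , j) ∈Vk S
    down c≤c = sc-down j≤i
    down ℓ≤ℓ = sℓ-down j≤i
    down r≤r = sr-down j≤i
    down c≤ℓ = sc-down j≤i ∘ sℓ⊆sc
    down c≤r = sc-down j≤i ∘ sr⊆sc

numOrderIdeals≡∑downSets : ∀ k →
  numOrderIdeals k ≡ ∑[ s ∈ allSubsets k ] (χ (does (isDownSet? s)) * (#downSubsets s * #downSubsets s))
numOrderIdeals≡∑downSets k = begin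
  numOrderIdeals k
    ≡⟨ length-filter isOrderIdeal? (allSubVk k) ⟩
  ∑[ S ∈ allSubVk k ] χ (does (isOrderIdeal? S))
    ≡⟨ ∑-cong (allSubVk k) (λ S → cong χ
         (does-⇔ (isOrderIdeal⇔orderIdealTriple S) (isOrderIdeal? S) (orderIdealTriple? S))) ⟩
  ∑[ S ∈ allSubVk k ] χ (does (orderIdealTriple? S))
    ≡⟨ ∑-cartesianProduct L (cartesianProduct L L) (χ ∘ does ∘ orderIdealTriple?) ⟩
  ∑[ sc ∈ L ] ∑[ p ∈ cartesianProduct L L ] χ (does (orderIdealTriple? (sc , p)))
    ≡⟨ ∑-cong L (λ sc → ∑-cartesianProduct L L (λ p → χ (does (orderIdealTriple? (sc , p))))) ⟩
  ∑[ sc ∈ L ] ∑[ sℓ ∈ L ] ∑[ sr ∈ L ] χ (does (orderIdealTriple? (sc , sℓ , sr)))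
    ≡⟨ ∑-cong L ideals-over ⟩
  ∑[ sc ∈ L ] (χ (does (isDownSet? sc)) * (#downSubsets sc * #downSubsets sc)) ∎
  where
  open ≡-Reasoning
  L = allSubsets k

  ideals-over : ∀ sc →
    ∑[ sℓ ∈ L ] ∑[ sr ∈ L ] χ (does (orderIdealTriple? (sc , sℓ , sr)))
      ≡ χ (does (isDownSet? sc)) * (#downSubsets sc * #downSubsets sc)
  ideals-over sc = begin
    ∑[ sℓ ∈ L ] ∑[ sr ∈ L ] χ (does (orderIdealTriple? (sc , sℓ , sr)))
      ≡⟨ ∑-cong L (λ sℓ → ∑-cong L (λ sr →
           trans (χ-∧ d _) (cong (χ d *_) (χ-∧ (below sℓ) (below sr))))) ⟩
    ∑[ sℓ ∈ L ] ∑[ sr ∈ L ] (χ d * (χ (below sℓ) * χ (below sr)))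
      ≡⟨ trans (∑-cong L (λ sℓ → ∑-*ˡ L (χ d) _)) (∑-*ˡ L (χ d) _) ⟩
    χ d * ∑[ sℓ ∈ L ] ∑[ sr ∈ L ] (χ (below sℓ) * χ (below sr))
      ≡⟨ cong (χ d *_) (∑-*-∑ L L (χ ∘ below) (χ ∘ below)) ⟩
    χ d * (#downSubsets sc * #downSubsets sc) ∎
    where
    d = does (isDownSet? sc)
    below : Subset k → Bool
    below t = does (isDownSubset? t sc)

numOrderIdeals≡sumOfSquares : ∀ k → numOrderIdeals k ≡ sum (applyUpTo (λ i → suc i * suc i) (k + 1))
numOrderIdeals≡sumOfSquares k = begin
  numOrderIdeals k
    ≡⟨ numOrderIdeals≡∑downSets k ⟩
  ∑[ s ∈ allSubsets k ] (χ (does (isDownSet? s)) * (#downSubsets s * #downSubsets s))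
    ≡⟨ ∑-downSets k (λ m → m * m) ⟩
  sum (applyUpTo (λ i → suc i * suc i) (suc k))
    ≡⟨ cong (sum ∘ applyUpTo (λ i → suc i * suc i)) (ℕₚ.+-comm 1 k) ⟩
  sum (applyUpTo (λ i → suc i * suc i) (k + 1)) ∎
  where open ≡-Reasoning

sum-applyUpTo-suc : (f : ℕ → ℕ) (n : ℕ) → sum (applyUpTo f (suc n)) ≡ sum (applyUpTo f n) + f n
sum-applyUpTo-suc f n = begin
  sum (applyUpTo f (suc n))              ≡⟨ cong sum (sym (applyUpTo-∷ʳ f n)) ⟩
  sum (applyUpTo f n ∷ʳ f n)             ≡⟨ sum-++ (applyUpTo f n) (f n ∷ []) ⟩
  sum (applyUpTo f n) + (f n + 0)        ≡⟨ cong (sum (applyUpTo f n) +_) (ℕₚ.+-identityʳ (f n)) ⟩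
  sum (applyUpTo f n) + f n              ∎
  where open ≡-Reasoning

sumOfSquares*6 : ∀ n → sum (applyUpTo (λ i → suc i * suc i) n) * 6 ≡ n * (n + 1) * (2 * n + 1)
sumOfSquares*6 zero = refl
sumOfSquares*6 (suc n) = begin
  sum (applyUpTo sq (suc n)) * 6                 ≡⟨ cong (_* 6) (sum-applyUpTo-suc sq n) ⟩
  (sum (applyUpTo sq n) + sq n) * 6              ≡⟨ ℕₚ.*-distribʳ-+ 6 (sum (applyUpTo sq n)) (sq n) ⟩
  sum (applyUpTo sq n) * 6 + sq n * 6            ≡⟨ cong (_+ sq n * 6) (sumOfSquares*6 n) ⟩
  n * (n + 1) * (2 * n + 1) + suc n * suc n * 6  ≡⟨ step n ⟩
  suc n * (suc n + 1) * (2 * suc n + 1)          ∎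
  where
  open ≡-Reasoning
  sq : ℕ → ℕ
  sq i = suc i * suc i
  step : ∀ n → n * (n + 1) * (2 * n + 1) + (1 + n) * (1 + n) * 6 ≡ (1 + n) * (1 + n + 1) * (2 * (1 + n) + 1)
  step = solve-∀

sumOfSquares≡closedForm : ∀ k →
  sum (applyUpTo (λ i → suc i * suc i) (k + 1)) ≡ ((k + 1) * (k + 2) * (2 * k + 3)) / 6
sumOfSquares≡closedForm k = begin
  S                                                  ≡⟨ sym (m*n/n≡m S 6) ⟩
  S * 6 / 6                                          ≡⟨ cong (_/ 6) (sumOfSquares*6 (k + 1)) ⟩
  (k + 1) * (k + 1 + 1) * (2 * (k + 1) + 1) / 6      ≡⟨ cong (_/ 6) (normalise k) ⟩
  (k + 1) * (k + 2) * (2 * k + 3) / 6                ∎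
  where
  open ≡-Reasoning
  S = sum (applyUpTo (λ i → suc i * suc i) (k + 1))
  normalise : ∀ k → (k + 1) * (k + 1 + 1) * (2 * (k + 1) + 1) ≡ (k + 1) * (k + 2) * (2 * k + 3)
  normalise = solve-∀

proposition3p7 : (k : ℕ) → 1 ≤ k →
    (numOrderIdeals k ≡ sum (applyUpTo (λ i → suc i * suc i) (k + 1)))
    × (numOrderIdeals k ≡ ((k + 1) * (k + 2) * (2 * k + 3)) / 6)
proposition3p7 k _ =
  numOrderIdeals≡sumOfSquares k , trans (numOrderIdeals≡sumOfSquares k) (sumOfSquares≡closedForm k)
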